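{- Let $\lambda/\mu$ be a skew shape. For every $T\in\mathrm{SYT}(\lambda/\mu)$, the tableau $\mathrm{Rot}_{\mathrm{SE}}(T)$ is standard, i.e. $\mathrm{Rot}_{\mathrm{SE}}(T)\in\mathrm{SYT}(\lambda/\mu)$.
   Context: Conventions: $\mu\subseteq\lambda$ are partitions, $\lambda/\mu$ in English notation; cell $(r,c)$ is in row $r$ (numbered top to bottom) and column $c$; "north/south" = smaller/larger row index, "west/east" = smaller/larger column index. $n=|\lambda/\mu|$. $\mathrm{SYT}(\lambda/\mu)$ is the set of standard Young tableaux of shape $\lambda/\mu$ (bijective fillings by $\{1,\dots,n\}$ increasing along rows and down columns). $\mathrm{pos}_T(x)$ is the cell containing $x$. Connected components are with respect to edge-adjacency; distinct components of a skew shape are totally ordered southwest to northeast. The southeast boundary of $\lambda/\mu$ is the set of cells $(r,c)\in\lambda/\mu$ with $(r+1,c+1)\notin\lambda/\mu$. In each connected component these cells form a path where each cell is the northern or eastern neighbor of the previous; the southwest-to-northeast order on the southeast boundary lists each component's path in this order, components in southwest-to-northeast order. $S\subseteq\{1,\dots,n\}$ is southeast min-unimodal in $T$ if all $\mathrm{pos}_T(s)$, $s\in S$, lie on the southeast boundary in a single connected component of $\lambda/\mu$, and the entries read in southwest-to-northeast order of their cells strictly decrease down to $\min S$ and then strictly increase. $\mathrm{Rc}_{\mathrm{SE}}(T)=\{n,\dots,n-k+1\}$ with $k\ge1$ maximal such that this set is southeast min-unimodal; its cells, in southwest-to-northeast order, are $C_1,\dots,C_k$; $\mathrm{pos}_T(n)\in\{C_1,C_k\}$.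 Let $Y=\mathrm{pos}_T(n-k+1)=(r,c)$. Southeast rotation endpoint $X$: if $\mathrm{pos}_T(n)=C_1$, let $r'\ge r$ be maximal with $(r,c),\dots,(r',c)\in\lambda/\mu$; if $r'>r$ then $X=(r',c)$, otherwise $X=(r,c')$ with $c'\ge c$ maximal such that $(r,c),\dots,(r,c')\in\lambda/\mu$. If $\mathrm{pos}_T(n)=C_k$ (and $k>1$): let $c'\ge c$ be maximal with $(r,c),\dots,(r,c')\in\lambda/\mu$; if $c'>c$ then $X=(r,c')$, otherwise $X=(r',c)$ with $r'$ maximal such that $(r,c),\dots,(r',c)\in\lambda/\mu$. Then $X=C_j$ for some $j$. Southeast rotation $\mathrm{Rot}_{\mathrm{SE}}(T)$: if $\mathrm{pos}_T(n)=C_1$, place $n$ in $C_j$ and move the entry of $C_m$ to $C_{m-1}$ for $2\le m\le j$; if $\mathrm{pos}_T(n)=C_k$, place $n$ in $C_j$ and move the entry of $C_m$ to $C_{m+1}$ for $j\le m\le k-1$; all other entries are unchanged. -}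

module Defs where

open import Data.Nat using (ℕ; zero; suc; _+_; _∸_; _≤_; _<_; _≟_; _<?_)
open import Data.List using (List; []; _∷_)
open import Data.Nat.ListAction using (sum)
open import Data.Product using (Σ; ∃; ∃-syntax; _×_; _,_)
open import Data.Product.Properties using (≡-dec)
open import Data.Sum using (_⊎_)
open import Data.Maybe using (Maybe; just; nothing)
open import Relation.Nullary using (¬_; yes; no)
open import Relation.Binary.PropositionalEquality using (_≡_; _≢_)

-- Conventions: rows and columns are numbered from 0 (row 0 is the top
-- row, column 0 the leftmost column).  A partition is a finite list of
-- row lengths (trailing zeros allowed); row p r is the length of row r
-- (0 beyond the end of the list).

row : List ℕ → ℕ → ℕ
row []       _       = 0
row (x ∷ xs) zero    = x
row (x ∷ xs) (suc r) = row xs r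

IsPartition : List ℕ → Set
IsPartition p = ∀ r → row p (suc r) ≤ row p r

_⊆ₚ_ : List ℕ → List ℕ → Set
mu ⊆ₚ lam = ∀ r → row mu r ≤ row lam r

Cell : Set
Cell = ℕ × ℕ

_≟c_ : (p q : Cell) → Relation.Nullary.Dec (p ≡ q)
_≟c_ = ≡-dec _≟_ _≟_

InShape : List ℕ → List ℕ → Cell → Set
InShape lam mu (r , c) = row mu r ≤ c × c < row lam r

size : List ℕ → List ℕ → ℕ
size lam mu = sum lam ∸ sum mu

-- a filling of the plane; only the values on cells of λ/μ matter
Tableau : Set
Tableau = Cell → ℕ

record IsSYT (lam mu : List ℕ) (T : Tableau) : Set where
  field
    range  : ∀ p → InShape lam mu p → 1 ≤ T p × T p ≤ size lam mu
    inj    : ∀ p q → InShape lam mu p → InShape lam mu q → T p ≡ T q → p ≡ q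
    surj   : ∀ v → 1 ≤ v → v ≤ size lam mu → ∃[ p ] (InShape lam mu p × T p ≡ v)
    rowInc : ∀ r c → InShape lam mu (r , c) → InShape lam mu (r , suc c) →
             T (r , c) < T (r , suc c)
    colInc : ∀ r c → InShape lam mu (r , c) → InShape lam mu (suc r , c) →
             T (r , c) < T (suc r , c)

Adj : Cell → Cell → Set
Adj (r , c) (r' , c') =
  (r' ≡ suc r × c' ≡ c) ⊎ (r ≡ suc r' × c ≡ c') ⊎
  (r' ≡ r × c' ≡ suc c) ⊎ (r ≡ r' × c ≡ suc c')

data Path (lam mu : List ℕ) : Cell → Cell → Set where
  stop : ∀ p → Path lam mu p p
  step : ∀ {p q s} → InShape lam mu q → Adj p q → Path lam mu q s → Path lam mu p s

SameComponent : List ℕ → List ℕ → Cell → Cell → Set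
SameComponent lam mu p q = InShape lam mu p × InShape lam mu q × Path lam mu p q

SEB : List ℕ → List ℕ → Cell → Set
SEB lam mu (r , c) = InShape lam mu (r , c) × ¬ InShape lam mu (suc r , suc c)

-- SEPath p q : q is reached from p along the southeast boundary, each cell
-- being the northern or eastern neighbour of the previous one
-- (this is the southwest-to-northeast order within a component)
data SEPath (lam mu : List ℕ) : Cell → Cell → Set where
  stop  : ∀ p → SEPath lam mu p p
  north : ∀ {r c s} → SEB lam mu (r , c) → SEPath lam mu (r , c) s →
          SEPath lam mu (suc r , c) s
  east  : ∀ {r c s} → SEB lam mu (r , suc c) → SEPath lam mu (r , suc c) s →
          SEPath lam mu (r , c) s

record IsTopCells (lam mu : List ℕ) (T : Tableau) (k : ℕ) (C : ℕ → Cell) : Set where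
  field
    bound    : k ≤ size lam mu
    onSEB    : ∀ i → 1 ≤ i → i ≤ k → SEB lam mu (C i)
    entries  : ∀ i → 1 ≤ i → i ≤ k → size lam mu ∸ k < T (C i) × T (C i) ≤ size lam mu
    covers   : ∀ v → size lam mu ∸ k < v → v ≤ size lam mu →
               ∃[ i ] (1 ≤ i × i ≤ k × T (C i) ≡ v)
    sameComp : ∀ i i' → 1 ≤ i → i ≤ k → 1 ≤ i' → i' ≤ k →
               SameComponent lam mu (C i) (C i')
    ordered  : ∀ i i' → 1 ≤ i → i < i' → i' ≤ k →
               SEPath lam mu (C i) (C i') × C i ≢ C i'

SEMinUnimodal : List ℕ → List ℕ → Tableau → ℕ → Set
SEMinUnimodal lam mu T k =
  Σ (ℕ → Cell) λ C → IsTopCells lam mu T k C ×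
    ∃[ m ] (1 ≤ m × m ≤ k × T (C m) ≡ size lam mu ∸ k + 1 ×
            (∀ i → 1 ≤ i → i < m → T (C (suc i)) < T (C i)) ×
            (∀ i → m ≤ i → i < k → T (C i) < T (C (suc i))))

IsRcSESize : List ℕ → List ℕ → Tableau → ℕ → Set
IsRcSESize lam mu T k =
  1 ≤ k × SEMinUnimodal lam mu T k × (∀ k' → k < k' → ¬ SEMinUnimodal lam mu T k')

ColEnd : List ℕ → List ℕ → Cell → ℕ → Set
ColEnd lam mu (r , c) r' =
  r ≤ r' × (∀ i → r ≤ i → i ≤ r' → InShape lam mu (i , c)) × ¬ InShape lam mu (suc r' , c)

RowEnd : List ℕ → List ℕ → Cell → ℕ → Set
RowEnd lam mu (r , c) c' =
  c ≤ c' × (∀ i → c ≤ i → i ≤ c' → InShape lam mu (r , i)) × ¬ InShape lam mu (r , suc c')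

-- southeast rotation endpoint X determined by Y = pos_T(n-k+1)
-- (first case: pos_T(n) = C₁, i.e. T(C₁) = n; otherwise pos_T(n) = C_k)
SEEndpoint : List ℕ → List ℕ → Tableau → (ℕ → Cell) → Cell → Cell → Set
SEEndpoint lam mu T C (r , c) X =
  (T (C 1) ≡ size lam mu ×
     ∃[ r' ] (ColEnd lam mu (r , c) r' ×
       ((r < r' × X ≡ (r' , c)) ⊎
        (r' ≡ r × ∃[ c' ] (RowEnd lam mu (r , c) c' × X ≡ (r , c'))))))
  ⊎
  (T (C 1) ≢ size lam mu ×
     ∃[ c' ] (RowEnd lam mu (r , c) c' ×
       ((c < c' × X ≡ (r , c')) ⊎
        (c' ≡ c × ∃[ r' ] (ColEnd lam mu (r , c) r' × X ≡ (r' , c))))))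

findIdx : (ℕ → Cell) → Cell → ℕ → Maybe ℕ
findIdx C p zero = nothing
findIdx C p (suc b) with findIdx C p b
... | just m  = just m
... | nothing with C (suc b) ≟c p
...   | yes _ = just (suc b)
...   | no _  = nothing

rot₁ : ℕ → (ℕ → Cell) → ℕ → Tableau → Tableau
rot₁ n C j T p with findIdx C p j
... | nothing = T p
... | just m with m ≟ j
...   | yes _ = n
...   | no _  = T (C (suc m))

rot₂ : ℕ → ℕ → (ℕ → Cell) → ℕ → Tableau → Tableau
rot₂ n k C j T p with findIdx C p k
... | nothing = T p
... | just m with m ≟ j
...   | yes _ = n
...   | no _ with j <? m
...     | yes _ = T (C (m ∸ 1))
...     | no _  = T p

-- Rot_SE(T), given n, k, the cells C₁..C_k and the index j with X = C_j
rotSE : ℕ → ℕ → (ℕ → Cell) → ℕ → Tableau → Tableau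
rotSE n k C j T with T (C 1) ≟ n
... | yes _ = rot₁ n C j T
... | no _  = rot₂ n k C j T

module Submission where

-- Read along the southeast boundary, the top entries n−k+1, …, n in C₁, …, C_k form a valley:
-- they decrease down to Y = C_m, then increase, and n sits at C₁ or at C_k. Each step along the
-- boundary raises the content c − r by exactly one, so among the top cells the east neighbour of
-- C_l can only be C_{l+1} and its south neighbour only C_{l−1}; hence rows run through ascents and
-- columns through descents of the valley. The rotation permutes the top entries along a cycle of
-- indices and fixes every other entry, so it is again a bijection onto 1, …, n and only adjacent
-- pairs of top cells need checking. Shifting by one index keeps ascents on the rising side and
-- descents on the falling side; the only places where this could fail are the end X = C_j, which
-- is a corner of λ/μ, and the bottom C_m, whose offending neighbour is excluded by the choice of X.

open import Defs
open import Data.Nat using (ℕ; zero; suc; pred; _≤_; _<_; _∸_; _+_; z≤n; s≤s; _≟_; _<?_; _≤?_)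
open import Data.Nat.Properties
open import Data.List using (List)
open import Data.Product using (∃-syntax; _×_; _,_; proj₁; proj₂)
open import Data.Sum using (_⊎_; inj₁; inj₂)
open import Data.Empty using (⊥; ⊥-elim)
open import Data.Maybe using (just; nothing)
open import Relation.Nullary using (¬_; yes; no; _×-dec_)
open import Relation.Binary.PropositionalEquality
open import Function using (_∘_; case_of_)
open import Relation.Binary.Definitions using (tri<; tri≈; tri>)

module Increasing {A : Set} (_≺_ : A → A → Set) (≺-asym : ∀ {x y} → x ≺ y → ¬ y ≺ x) where

  ≺-irrefl : ∀ {x} → ¬ x ≺ x
  ≺-irrefl x≺x = ≺-asym x≺x x≺x

  IncreasingOn : ℕ → (ℕ → A) → Set
  IncreasingOn k f = ∀ {i i'} → 1 ≤ i → i < i' → i' ≤ k → f i ≺ f i'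

  _⋖_ : A → A → Set
  x ⋖ y = x ≺ y × (∀ {z} → x ≺ z → ¬ z ≺ y)

  module _ {k : ℕ} {f : ℕ → A} (inc : IncreasingOn k f) where

    increasing-reflects : ∀ {i i'} → 1 ≤ i → i ≤ k → 1 ≤ i' → i' ≤ k → f i ≺ f i' → i < i'
    increasing-reflects {i} {i'} 1≤i i≤k 1≤i' i'≤k fi≺fi' with <-cmp i i'
    ... | tri< i<i' _ _ = i<i'
    ... | tri≈ _ refl _ = ⊥-elim (≺-irrefl fi≺fi')
    ... | tri> _ _ i'<i = ⊥-elim (≺-asym fi≺fi' (inc 1≤i' i'<i i≤k))

    increasing-injective : ∀ {i i'} → 1 ≤ i → i ≤ k → 1 ≤ i' → i' ≤ k → f i ≡ f i' → i ≡ i'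
    increasing-injective {i} {i'} 1≤i i≤k 1≤i' i'≤k fi≡fi' with <-cmp i i'
    ... | tri< i<i' _ _ = ⊥-elim (≺-irrefl (subst (f i ≺_) (sym fi≡fi') (inc 1≤i i<i' i'≤k)))
    ... | tri≈ _ i≡i' _ = i≡i'
    ... | tri> _ _ i'<i = ⊥-elim (≺-irrefl (subst (_≺ f i) (sym fi≡fi') (inc 1≤i' i'<i i≤k)))

    increasing-⋖⇒suc : ∀ {i i'} → 1 ≤ i → i ≤ k → 1 ≤ i' → i' ≤ k → f i ⋖ f i' → i' ≡ suc i
    increasing-⋖⇒suc 1≤i i≤k 1≤i' i'≤k (fi≺fi' , nothing-between)
      with m≤n⇒m<n∨m≡n (increasing-reflects 1≤i i≤k 1≤i' i'≤k fi≺fi')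
    ... | inj₂ i'≡suc-i = sym i'≡suc-i
    ... | inj₁ suc-i<i' =
      ⊥-elim (nothing-between (inc 1≤i ≤-refl (<⇒≤ (<-≤-trans suc-i<i' i'≤k)))
                              (inc (s≤s z≤n) suc-i<i' i'≤k))

  increasing-index-≤ : ∀ {k} {f g : ℕ → A} → IncreasingOn k f → IncreasingOn k g →
            (∀ {i} → 1 ≤ i → i ≤ k → ∃[ s ] (1 ≤ s × s ≤ k × g s ≡ f i)) →
            ∀ {i s} → 1 ≤ i → i ≤ k → 1 ≤ s → s ≤ k → f i ≡ g s → i ≤ s
  increasing-index-≤ f-inc g-inc g-covers {suc zero} _ _ 1≤s _ _ = 1≤s
  increasing-index-≤ f-inc g-inc g-covers {suc (suc i)} _ i≤k 1≤s s≤k fi≡gs =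
    let s' , 1≤s' , s'≤k , gs'≡fi = g-covers {suc i} (s≤s z≤n) (<⇒≤ i≤k)
        i+1≤s' = increasing-index-≤ f-inc g-inc g-covers {suc i}
                   (s≤s z≤n) (<⇒≤ i≤k) 1≤s' s'≤k (sym gs'≡fi)
        s'<s = increasing-reflects g-inc 1≤s' s'≤k 1≤s s≤k
                 (subst₂ _≺_ (sym gs'≡fi) fi≡gs (f-inc (s≤s z≤n) ≤-refl i≤k))
    in ≤-trans (s≤s i+1≤s') s'<s

  increasing-unique : ∀ {k} {f g : ℕ → A} → IncreasingOn k f → IncreasingOn k g →
                      (∀ {i} → 1 ≤ i → i ≤ k → ∃[ s ] (1 ≤ s × s ≤ k × g s ≡ f i)) →
                      (∀ {s} → 1 ≤ s → s ≤ k → ∃[ i ] (1 ≤ i × i ≤ k × f i ≡ g s)) →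
                      ∀ {i} → 1 ≤ i → i ≤ k → f i ≡ g i
  increasing-unique f-inc g-inc g-covers f-covers {i} 1≤i i≤k with g-covers 1≤i i≤k
  ... | s , 1≤s , s≤k , gs≡fi = trans (sym gs≡fi) (cong _ (sym i≡s))
    where
    i≡s : i ≡ s
    i≡s = ≤-antisym (increasing-index-≤ f-inc g-inc g-covers 1≤i i≤k 1≤s s≤k (sym gs≡fi))
                    (increasing-index-≤ g-inc f-inc f-covers 1≤s s≤k 1≤i i≤k gs≡fi)

-- p ≺ q: the content c − r of p is smaller than that of q, compared without subtraction.
_≺_ : Cell → Cell → Set
(r , c) ≺ (r' , c') = c + r' < c' + r

≺-asym : ∀ {p q} → p ≺ q → ¬ q ≺ p
≺-asym {_ , _} {_ , _} = <-asym

open Increasing _≺_ (λ {p} {q} → ≺-asym {p} {q})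

no-ℕ-between : ∀ {a b} → a < b → b < suc a → ⊥
no-ℕ-between a<b b<1+a = <⇒≱ a<b (≤-pred b<1+a)

east-⋖ : ∀ {r c} → (r , c) ⋖ (r , suc c)
east-⋖ = n<1+n _ , λ p≺x x≺q → no-ℕ-between p≺x x≺q

south-⋖ : ∀ {r c} → (suc r , c) ⋖ (r , c)
south-⋖ {r} {c} = subst (c + r <_) (sym (+-suc c r)) (n<1+n _)
                , λ {(x , y)} p≺x x≺q → no-ℕ-between x≺q (subst (c + x <_) (+-suc y r) p≺x)

module _ {lam mu : List ℕ} where

  sePath⇒≺ : ∀ {p q} → SEPath lam mu p q → p ≡ q ⊎ p ≺ q
  sePath⇒≺ (stop p) = inj₁ refl
  sePath⇒≺ (north {r} {c} _ rest) with sePath⇒≺ rest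
  ... | inj₁ refl = inj₂ (proj₁ (south-⋖ {r} {c}))
  ... | inj₂ ≺s   = inj₂ (≤-trans ≺s (+-monoʳ-≤ _ (n≤1+n r)))
  sePath⇒≺ (east {r} {c} _ rest) with sePath⇒≺ rest
  ... | inj₁ refl = inj₂ (proj₁ (east-⋖ {r} {c}))
  ... | inj₂ ≺s   = inj₂ (<-trans (n<1+n _) ≺s)

row-antitone : ∀ {p} → IsPartition p → ∀ {a b} → a ≤ b → row p b ≤ row p a
row-antitone {p} part {b = zero} z≤n = ≤-refl
row-antitone {p} part {b = suc b} a≤1+b with m≤n⇒m<n∨m≡n a≤1+b
... | inj₂ refl = ≤-refl
... | inj₁ a<1+b = ≤-trans (part b) (row-antitone {p} part (≤-pred a<1+b))

south-of east-of : Cell → Cell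
south-of (r , c) = suc r , c
east-of (r , c) = r , suc c

IsCorner : List ℕ → List ℕ → Cell → Set
IsCorner lam mu p = ¬ InShape lam mu (south-of p) × ¬ InShape lam mu (east-of p)

module Shape {lam mu : List ℕ} (λ-partition : IsPartition lam) (μ-partition : IsPartition mu) where

  inShape-between : ∀ {r₁ c₁ r₂ c₂ r c} → InShape lam mu (r₁ , c₁) → InShape lam mu (r₂ , c₂) →
                    r₁ ≤ r → r ≤ r₂ → c₁ ≤ c → c ≤ c₂ → InShape lam mu (r , c)
  inShape-between (μ≤c₁ , _) (_ , c₂<λ) r₁≤r r≤r₂ c₁≤c c≤c₂ =
    ≤-trans (row-antitone {mu} μ-partition r₁≤r) (≤-trans μ≤c₁ c₁≤c) ,
    <-≤-trans (≤-<-trans c≤c₂ c₂<λ) (row-antitone {lam} λ-partition r≤r₂)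

  column-first-endpoint :
    ∀ {r c r' X} → SEB lam mu (r , c) → ColEnd lam mu (r , c) r' →
    (r < r' × X ≡ (r' , c)) ⊎ (r' ≡ r × ∃[ c' ] (RowEnd lam mu (r , c) c' × X ≡ (r , c'))) →
    IsCorner lam mu X × (¬ InShape lam mu (south-of (r , c)) ⊎ X ≺ (r , c))
  column-first-endpoint {r} {c} (Y∈ , Y-seb) (_ , _ , column-ends) (inj₁ (r<r' , refl)) =
    (column-ends , λ X-east∈ → Y-seb (inShape-between Y∈ X-east∈ (n≤1+n r) r<r' (n≤1+n c) ≤-refl)) ,
    inj₂ (+-monoʳ-< c r<r')
  column-first-endpoint {r} {c} (Y∈ , _) (_ , _ , column-ends) (inj₂ (refl , c' , (c≤c' , _ , row-ends) , refl)) =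
    (( λ X-south∈ → column-ends (inShape-between Y∈ X-south∈ (n≤1+n r) ≤-refl ≤-refl c≤c')) , row-ends) ,
    inj₁ column-ends

  row-first-endpoint :
    ∀ {r c c' X} → SEB lam mu (r , c) → RowEnd lam mu (r , c) c' →
    (c < c' × X ≡ (r , c')) ⊎ (c' ≡ c × ∃[ r' ] (ColEnd lam mu (r , c) r' × X ≡ (r' , c))) →
    IsCorner lam mu X × (¬ InShape lam mu (east-of (r , c)) ⊎ (r , c) ≺ X)
  row-first-endpoint {r} {c} (Y∈ , Y-seb) (_ , _ , row-ends) (inj₁ (c<c' , refl)) =
    ((λ X-south∈ → Y-seb (inShape-between Y∈ X-south∈ (n≤1+n r) ≤-refl (n≤1+n c) c<c')) , row-ends) ,
    inj₂ (+-monoˡ-< r c<c')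
  row-first-endpoint {r} {c} (Y∈ , _) (_ , _ , row-ends) (inj₂ (refl , r' , (r≤r' , _ , column-ends) , refl)) =
    (column-ends , λ X-east∈ → row-ends (inShape-between Y∈ X-east∈ ≤-refl r≤r' (n≤1+n c) ≤-refl)) ,
    inj₁ row-ends

-- next a b is the cycle b ↦ a, i ↦ i + 1 on [a, b] and prev a b its inverse. In the cell C i,
-- rot₁ places the old entry of C (next 1 j i), and rot₂ that of C (prev j k i).
next prev : ℕ → ℕ → ℕ → ℕ
next a b i with i ≟ b | a ≤? i ×-dec i <? b
... | yes _ | _     = a
... | no _  | yes _ = suc i
... | no _  | no _  = i
prev a b i with i ≟ a | a <? i ×-dec i ≤? b
... | yes _ | _     = b
... | no _  | yes _ = pred i
... | no _  | no _  = i

module _ {a b : ℕ} where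

  next-last : next a b b ≡ a
  next-last with b ≟ b
  ... | yes _   = refl
  ... | no b≢b = ⊥-elim (b≢b refl)

  next-inside : ∀ {i} → a ≤ i → i < b → next a b i ≡ suc i
  next-inside {i} a≤i i<b with i ≟ b | a ≤? i ×-dec i <? b
  ... | yes refl | _ = ⊥-elim (<-irrefl refl i<b)
  ... | no _ | yes _ = refl
  ... | no _ | no ¬inside = ⊥-elim (¬inside (a≤i , i<b))

  next-outside : ∀ {i} → i ≢ b → ¬ (a ≤ i × i < b) → next a b i ≡ i
  next-outside {i} i≢b ¬inside with i ≟ b | a ≤? i ×-dec i <? b
  ... | yes i≡b | _ = ⊥-elim (i≢b i≡b)
  ... | no _ | yes inside = ⊥-elim (¬inside inside)
  ... | no _ | no _ = refl

  prev-first : prev a b a ≡ b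
  prev-first with a ≟ a
  ... | yes _   = refl
  ... | no a≢a = ⊥-elim (a≢a refl)

  prev-inside : ∀ {i} → a < i → i ≤ b → prev a b i ≡ pred i
  prev-inside {i} a<i i≤b with i ≟ a | a <? i ×-dec i ≤? b
  ... | yes refl | _ = ⊥-elim (<-irrefl refl a<i)
  ... | no _ | yes _ = refl
  ... | no _ | no ¬inside = ⊥-elim (¬inside (a<i , i≤b))

  prev-outside : ∀ {i} → i ≢ a → ¬ (a < i × i ≤ b) → prev a b i ≡ i
  prev-outside {i} i≢a ¬inside with i ≟ a | a <? i ×-dec i ≤? b
  ... | yes i≡a | _ = ⊥-elim (i≢a i≡a)
  ... | no _ | yes inside = ⊥-elim (¬inside inside)
  ... | no _ | no _ = refl

  next-cases : ∀ i → i ≡ b ⊎ (a ≤ i × i < b) ⊎ (i ≢ b × ¬ (a ≤ i × i < b))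
  next-cases i with i ≟ b | a ≤? i ×-dec i <? b
  ... | yes i≡b | _ = inj₁ i≡b
  ... | no _ | yes inside = inj₂ (inj₁ inside)
  ... | no i≢b | no ¬inside = inj₂ (inj₂ (i≢b , ¬inside))

  prev-cases : ∀ i → i ≡ a ⊎ (a < i × i ≤ b) ⊎ (i ≢ a × ¬ (a < i × i ≤ b))
  prev-cases i with i ≟ a | a <? i ×-dec i ≤? b
  ... | yes i≡a | _ = inj₁ i≡a
  ... | no _ | yes inside = inj₂ (inj₁ inside)
  ... | no i≢a | no ¬inside = inj₂ (inj₂ (i≢a , ¬inside))

  prev-next : a ≤ b → ∀ i → prev a b (next a b i) ≡ i
  prev-next a≤b i with next-cases i
  ... | inj₁ refl = trans (cong (prev a b) next-last) prev-first
  ... | inj₂ (inj₁ (a≤i , i<b)) =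
    trans (cong (prev a b) (next-inside a≤i i<b)) (prev-inside (s≤s a≤i) i<b)
  ... | inj₂ (inj₂ (i≢b , ¬inside)) =
    trans (cong (prev a b) (next-outside i≢b ¬inside)) (prev-outside i≢a ¬inside')
    where
    i≢a : i ≢ a
    i≢a refl = ¬inside (≤-refl , ≤∧≢⇒< a≤b i≢b)
    ¬inside' : ¬ (a < i × i ≤ b)
    ¬inside' (a<i , i≤b) = ¬inside (<⇒≤ a<i , ≤∧≢⇒< i≤b i≢b)

  next-prev : a ≤ b → ∀ i → next a b (prev a b i) ≡ i
  next-prev a≤b i with prev-cases i
  ... | inj₁ refl = trans (cong (next a b) prev-first) next-last
  ... | inj₂ (inj₁ (s≤s a≤i₀ , i≤b)) =
    trans (cong (next a b) (prev-inside (s≤s a≤i₀) i≤b)) (next-inside a≤i₀ i≤b)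
  ... | inj₂ (inj₂ (i≢a , ¬inside)) =
    trans (cong (next a b) (prev-outside i≢a ¬inside)) (next-outside i≢b ¬inside')
    where
    i≢b : i ≢ b
    i≢b refl = ¬inside (≤∧≢⇒< a≤b (i≢a ∘ sym) , ≤-refl)
    ¬inside' : ¬ (a ≤ i × i < b)
    ¬inside' (a≤i , i<b) = ¬inside (≤∧≢⇒< a≤i (i≢a ∘ sym) , <⇒≤ i<b)

  next-above : ∀ {i} → b < i → next a b i ≡ i
  next-above b<i = next-outside (>⇒≢ b<i) (λ (_ , i<b) → <-asym i<b b<i)

  prev-below : ∀ {i} → i < a → prev a b i ≡ i
  prev-below i<a = prev-outside (<⇒≢ i<a) (λ (a<i , _) → <-asym i<a a<i)

  module _ {k : ℕ} (1≤a : 1 ≤ a) (a≤b : a ≤ b) (b≤k : b ≤ k) where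

    next-closed : ∀ {i} → 1 ≤ i → i ≤ k → 1 ≤ next a b i × next a b i ≤ k
    next-closed {i} 1≤i i≤k with next-cases i
    ... | inj₁ refl = subst (λ x → 1 ≤ x × x ≤ k) (sym next-last) (1≤a , ≤-trans a≤b b≤k)
    ... | inj₂ (inj₁ (a≤i , i<b)) =
      subst (λ x → 1 ≤ x × x ≤ k) (sym (next-inside a≤i i<b)) (s≤s z≤n , ≤-trans i<b b≤k)
    ... | inj₂ (inj₂ (i≢b , ¬inside)) =
      subst (λ x → 1 ≤ x × x ≤ k) (sym (next-outside i≢b ¬inside)) (1≤i , i≤k)

    prev-closed : ∀ {i} → 1 ≤ i → i ≤ k → 1 ≤ prev a b i × prev a b i ≤ k
    prev-closed {i} 1≤i i≤k with prev-cases i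
    ... | inj₁ refl = subst (λ x → 1 ≤ x × x ≤ k) (sym prev-first) (≤-trans 1≤a a≤b , b≤k)
    ... | inj₂ (inj₁ (a<i , i≤b)) =
      subst (λ x → 1 ≤ x × x ≤ k) (sym (prev-inside a<i i≤b)) (≤-trans 1≤a (pred-mono-≤ a<i) , ≤-trans pred[n]≤n i≤k)
    ... | inj₂ (inj₂ (i≢a , ¬inside)) =
      subst (λ x → 1 ≤ x × x ≤ k) (sym (prev-outside i≢a ¬inside)) (1≤i , i≤k)

record InverseOn (k : ℕ) (π ρ : ℕ → ℕ) : Set where
  field
    π-closed : ∀ {i} → 1 ≤ i → i ≤ k → 1 ≤ π i × π i ≤ k
    ρ-closed : ∀ {i} → 1 ≤ i → i ≤ k → 1 ≤ ρ i × ρ i ≤ k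
    ρ∘π : ∀ {i} → 1 ≤ i → i ≤ k → ρ (π i) ≡ i
    π∘ρ : ∀ {i} → 1 ≤ i → i ≤ k → π (ρ i) ≡ i

InverseOn-sym : ∀ {k π ρ} → InverseOn k π ρ → InverseOn k ρ π
InverseOn-sym inv = record { π-closed = ρ-closed ; ρ-closed = π-closed ; ρ∘π = π∘ρ ; π∘ρ = ρ∘π }
  where open InverseOn inv

cycle-inverse : ∀ {a b k} → 1 ≤ a → a ≤ b → b ≤ k → InverseOn k (next a b) (prev a b)
cycle-inverse 1≤a a≤b b≤k = record
  { π-closed = next-closed 1≤a a≤b b≤k
  ; ρ-closed = prev-closed 1≤a a≤b b≤k
  ; ρ∘π = λ {i} _ _ → prev-next a≤b i
  ; π∘ρ = λ {i} _ _ → next-prev a≤b i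
  }

record Valley (f : ℕ → ℕ) (k m : ℕ) : Set where
  field
    1≤m : 1 ≤ m
    m≤k : m ≤ k
    descending : ∀ i → 1 ≤ i → i < m → f (suc i) < f i
    ascending  : ∀ i → m ≤ i → i < k → f i < f (suc i)

  ascent⇒≥bottom : ∀ {i} → 1 ≤ i → f i < f (suc i) → m ≤ i
  ascent⇒≥bottom {i} 1≤i rise with m ≤? i
  ... | yes m≤i = m≤i
  ... | no m≰i  = ⊥-elim (<-asym rise (descending i 1≤i (≰⇒> m≰i)))

  descent⇒<bottom : ∀ {i} → suc i ≤ k → f (suc i) < f i → i < m
  descent⇒<bottom {i} i<k fall with m ≤? i
  ... | yes m≤i = ⊥-elim (<-asym fall (ascending i m≤i i<k))
  ... | no m≰i  = ≰⇒> m≰i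

  maximum-at-end : ∀ {n} → (∀ {i} → 1 ≤ i → i ≤ k → f i ≤ n) →
                   ∀ {i} → 1 ≤ i → i ≤ k → f i ≡ n → i ≡ 1 ⊎ i ≡ k
  maximum-at-end f≤n {i} 1≤i i≤k fi≡n with m≤n⇒m<n∨m≡n i≤k
  ... | inj₂ i≡k = inj₂ i≡k
  ... | inj₁ i<k with m ≤? i
  ...   | yes m≤i =
    ⊥-elim (<⇒≱ (ascending i m≤i i<k) (subst (f (suc i) ≤_) (sym fi≡n) (f≤n (s≤s z≤n) i<k)))
  maximum-at-end f≤n {suc zero} _ _ _ | inj₁ _ | no _ = inj₁ refl
  maximum-at-end f≤n {suc (suc i)} _ i≤k fi≡n | inj₁ _ | no m≰i =
    ⊥-elim (<⇒≱ (descending (suc i) (s≤s z≤n) (<-trans (n<1+n _) (≰⇒> m≰i)))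
                (subst (f (suc i) ≤_) (sym fi≡n) (f≤n (s≤s z≤n) (<⇒≤ i≤k))))

module ValleyRotation {f : ℕ → ℕ} {k m n : ℕ} (valley : Valley f k m)
  (f≤n : ∀ {i} → 1 ≤ i → i ≤ k → f i ≤ n)
  (f-injective : ∀ {i i'} → 1 ≤ i → i ≤ k → 1 ≤ i' → i' ≤ k → f i ≡ f i' → i ≡ i') where
  open Valley valley

  below-top : ∀ {t i} → 1 ≤ t → t ≤ k → f t ≡ n → 1 ≤ i → i ≤ k → i ≢ t → f i < f t
  below-top {t} {i} 1≤t t≤k ft≡n 1≤i i≤k i≢t =
    ≤∧≢⇒< (subst (f i ≤_) (sym ft≡n) (f≤n 1≤i i≤k)) (i≢t ∘ f-injective 1≤i i≤k 1≤t t≤k)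

  via : ∀ {x y x' y'} → x ≡ x' → y ≡ y' → f x' < f y' → f x < f y
  via refl refl fx<fy = fx<fy

  module FirstMax (f1≡n : f 1 ≡ n) {j : ℕ} (j≤k : j ≤ k) where

    ascent-preserved : ∀ {l} → 1 ≤ l → suc l ≤ k → l ≢ j → f l < f (suc l) →
                       f (next 1 j l) < f (next 1 j (suc l))
    ascent-preserved {l} 1≤l l<k l≢j rise with <-cmp l j
    ... | tri≈ _ l≡j _ = ⊥-elim (l≢j l≡j)
    ... | tri> _ _ j<l = via (next-above j<l) (next-above (<-trans j<l (n<1+n l))) rise
    ... | tri< l<j _ _ with m≤n⇒m<n∨m≡n l<j
    ...   | inj₁ l+1<j = via (next-inside 1≤l l<j) (next-inside (s≤s z≤n) l+1<j)
                           (ascending (suc l) (≤-trans (ascent⇒≥bottom 1≤l rise) (n≤1+n l))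
                                      (<-≤-trans l+1<j j≤k))
    ...   | inj₂ refl = via (next-inside 1≤l l<j) (next-last {1} {suc l})
                          (below-top ≤-refl (≤-trans (s≤s z≤n) l<k) f1≡n (s≤s z≤n) l<k (>⇒≢ (s≤s 1≤l)))

    descent-preserved : ∀ {l} → 1 ≤ l → suc l ≤ k → suc l ≢ j → ¬ (suc l ≡ m × m < j) →
                        f (suc l) < f l → f (next 1 j (suc l)) < f (next 1 j l)
    descent-preserved {l} 1≤l l<k l+1≢j ¬bottom fall with <-cmp (suc l) j
    ... | tri≈ _ l+1≡j _ = ⊥-elim (l+1≢j l+1≡j)
    ... | tri< l+1<j _ _ = via (next-inside (s≤s z≤n) l+1<j) (next-inside 1≤l (<-trans (n<1+n l) l+1<j))
                             (descending (suc l) (s≤s z≤n) l+1<m)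
      where
      l+1<m : suc l < m
      l+1<m = ≤∧≢⇒< (descent⇒<bottom l<k fall) (λ l+1≡m → ¬bottom (l+1≡m , subst (_< j) l+1≡m l+1<j))
    ... | tri> _ _ j<l+1 with m≤n⇒m<n∨m≡n (≤-pred j<l+1)
    ...   | inj₁ j<l = via (next-above j<l+1) (next-above j<l) fall
    ...   | inj₂ refl = via (next-above j<l+1) (next-last {1} {l})
                          (below-top ≤-refl (≤-trans (s≤s z≤n) l<k) f1≡n (s≤s z≤n) l<k (>⇒≢ (s≤s 1≤l)))

  module LastMax (fk≡n : f k ≡ n) {j : ℕ} (1≤j : 1 ≤ j) where

    ascent-preserved : ∀ {l} → 1 ≤ l → suc l ≤ k → l ≢ j → ¬ (l ≡ m × j < m) → f l < f (suc l) →
                       f (prev j k l) < f (prev j k (suc l))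
    ascent-preserved {l} 1≤l l<k l≢j ¬bottom rise with <-cmp l j
    ... | tri≈ _ l≡j _ = ⊥-elim (l≢j l≡j)
    ... | tri< l<j _ _ with m≤n⇒m<n∨m≡n l<j
    ...   | inj₁ l+1<j = via (prev-below l<j) (prev-below l+1<j) rise
    ...   | inj₂ refl = via (prev-below l<j) (prev-first {suc l} {k})
                          (below-top (≤-trans 1≤l (<⇒≤ l<k)) ≤-refl fk≡n 1≤l (<⇒≤ l<k) (<⇒≢ l<k))
    ascent-preserved {suc l₀} 1≤l l<k l≢j ¬bottom rise | tri> _ _ j<l =
      via (prev-inside j<l (<⇒≤ l<k)) (prev-inside (<-trans j<l (n<1+n _)) l<k)
          (ascending l₀ m≤l₀ (<-trans (n<1+n l₀) l<k))
      where
      m≤l₀ : m ≤ l₀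
      m≤l₀ = ≤-pred (≤∧≢⇒< (ascent⇒≥bottom 1≤l rise)
                           (λ m≡l → ¬bottom (sym m≡l , subst (j <_) (sym m≡l) j<l)))

    descent-preserved : ∀ {l} → 1 ≤ l → suc l ≤ k → suc l ≢ j → f (suc l) < f l →
                        f (prev j k (suc l)) < f (prev j k l)
    descent-preserved {l} 1≤l l<k l+1≢j fall with <-cmp l j
    ... | tri< l<j _ _ = via (prev-below (≤∧≢⇒< l<j l+1≢j)) (prev-below l<j) fall
    ... | tri≈ _ refl _ = via (prev-inside (n<1+n l) l<k) (prev-first {l} {k})
                            (below-top (≤-trans 1≤l (<⇒≤ l<k)) ≤-refl fk≡n 1≤l (<⇒≤ l<k) (<⇒≢ l<k))
    descent-preserved {suc l₀} 1≤l l<k l+1≢j fall | tri> _ _ j<l =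
      via (prev-inside (<-trans j<l (n<1+n _)) l<k) (prev-inside j<l (<⇒≤ l<k))
          (descending l₀ (≤-trans 1≤j (≤-pred j<l)) (<-trans (n<1+n l₀) (descent⇒<bottom l<k fall)))

topCells-increasing : ∀ {lam mu T k C} → IsTopCells lam mu T k C → IncreasingOn k C
topCells-increasing top {i} {i'} 1≤i i<i' i'≤k with IsTopCells.ordered top i i' 1≤i i<i' i'≤k
... | path , Ci≢Ci' with sePath⇒≺ path
...   | inj₁ Ci≡Ci' = ⊥-elim (Ci≢Ci' Ci≡Ci')
...   | inj₂ Ci≺Ci' = Ci≺Ci'

module TopCells {lam mu : List ℕ} {T : Tableau} (syt : IsSYT lam mu T)
                {k : ℕ} {C : ℕ → Cell} (top : IsTopCells lam mu T k C) where
  open IsSYT syt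
  open IsTopCells top

  n : ℕ
  n = size lam mu

  C-inShape : ∀ {i} → 1 ≤ i → i ≤ k → InShape lam mu (C i)
  C-inShape {i} 1≤i i≤k = proj₁ (onSEB i 1≤i i≤k)

  C-injective : ∀ {i i'} → 1 ≤ i → i ≤ k → 1 ≤ i' → i' ≤ k → C i ≡ C i' → i ≡ i'
  C-injective = increasing-injective (topCells-increasing top)

  top-value : ∀ {i} → 1 ≤ i → i ≤ k → n ∸ k < T (C i)
  top-value {i} 1≤i i≤k = proj₁ (entries i 1≤i i≤k)

  C-bounded : ∀ {i} → 1 ≤ i → i ≤ k → T (C i) ≤ n
  C-bounded {i} 1≤i i≤k = proj₂ (entries i 1≤i i≤k)

  top-cell : ∀ {p} → InShape lam mu p → n ∸ k < T p → ∃[ i ] (1 ≤ i × i ≤ k × C i ≡ p)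
  top-cell {p} p∈ big with covers (T p) big (proj₂ (range p p∈))
  ... | i , 1≤i , i≤k , TCi≡Tp = i , 1≤i , i≤k , inj (C i) p (C-inShape 1≤i i≤k) p∈ TCi≡Tp

  C-first : ∀ {i} → 1 ≤ i → i ≤ k → ∀ {i'} → 1 ≤ i' → i' < i → C i' ≢ C i
  C-first 1≤i i≤k 1≤i' i'<i Ci'≡Ci =
    <⇒≢ i'<i (C-injective 1≤i' (<⇒≤ (<-≤-trans i'<i i≤k)) 1≤i i≤k Ci'≡Ci)

  TC-injective : ∀ {i i'} → 1 ≤ i → i ≤ k → 1 ≤ i' → i' ≤ k → T (C i) ≡ T (C i') → i ≡ i'
  TC-injective 1≤i i≤k 1≤i' i'≤k TCi≡TCi' =
    C-injective 1≤i i≤k 1≤i' i'≤k (inj _ _ (C-inShape 1≤i i≤k) (C-inShape 1≤i' i'≤k) TCi≡TCi')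

  C-reflects : ∀ {i i'} → 1 ≤ i → i ≤ k → 1 ≤ i' → i' ≤ k → C i ≺ C i' → i < i'
  C-reflects = increasing-reflects {k} {C} (topCells-increasing top)

  east-neighbour-index : ∀ {l l'} → 1 ≤ l → l ≤ k → 1 ≤ l' → l' ≤ k → C l' ≡ east-of (C l) → l' ≡ suc l
  east-neighbour-index 1≤l l≤k 1≤l' l'≤k Cl'≡east =
    increasing-⋖⇒suc (topCells-increasing top) 1≤l l≤k 1≤l' l'≤k (subst (C _ ⋖_) (sym Cl'≡east) east-⋖)

  south-neighbour-index : ∀ {l l'} → 1 ≤ l → l ≤ k → 1 ≤ l' → l' ≤ k → C l' ≡ south-of (C l) → l ≡ suc l'
  south-neighbour-index 1≤l l≤k 1≤l' l'≤k Cl'≡south =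
    increasing-⋖⇒suc (topCells-increasing top) 1≤l' l'≤k 1≤l l≤k (subst (_⋖ C _) (sym Cl'≡south) south-⋖)

  T-east : ∀ {p q} → InShape lam mu p → InShape lam mu q → q ≡ east-of p → T p < T q
  T-east p∈ q∈ refl = rowInc _ _ p∈ q∈

  T-south : ∀ {p q} → InShape lam mu p → InShape lam mu q → q ≡ south-of p → T p < T q
  T-south p∈ q∈ refl = colInc _ _ p∈ q∈

  topCells-unique : ∀ {C'} → IsTopCells lam mu T k C' → ∀ {i} → 1 ≤ i → i ≤ k → C' i ≡ C i
  topCells-unique {C'} top' =
    increasing-unique (topCells-increasing top') (topCells-increasing top) (covered top' top) (covered top top')
    where
    covered : ∀ {A B} → IsTopCells lam mu T k A → IsTopCells lam mu T k B →
              ∀ {i} → 1 ≤ i → i ≤ k → ∃[ s ] (1 ≤ s × s ≤ k × B s ≡ A i)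
    covered {A} {B} topA topB {i} 1≤i i≤k with IsTopCells.entries topA i 1≤i i≤k
    ... | big , small with IsTopCells.covers topB (T (A i)) big small
    ...   | s , 1≤s , s≤k , TBs≡TAi =
      s , 1≤s , s≤k , inj (B s) (A i) (proj₁ (IsTopCells.onSEB topB s 1≤s s≤k))
                                     (proj₁ (IsTopCells.onSEB topA i 1≤i i≤k)) TBs≡TAi

  -- SEMinUnimodal speaks of some enumeration of the top cells; topCells-unique identifies it with C.
  valley-of : SEMinUnimodal lam mu T k → ∃[ m ] (Valley (T ∘ C) k m × T (C m) ≡ n ∸ k + 1)
  valley-of (C' , top' , m , 1≤m , m≤k , TC'm , descending' , ascending') =
    m , valley , trans (cong T (sym (same 1≤m m≤k))) TC'm
    where
    same : ∀ {i} → 1 ≤ i → i ≤ k → C' i ≡ C i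
    same = topCells-unique top'
    same-order : ∀ {i i'} → 1 ≤ i → i ≤ k → 1 ≤ i' → i' ≤ k → T (C' i) < T (C' i') → T (C i) < T (C i')
    same-order 1≤i i≤k 1≤i' i'≤k = subst₂ (λ x y → T x < T y) (same 1≤i i≤k) (same 1≤i' i'≤k)
    valley : Valley (T ∘ C) k m
    valley = record
      { 1≤m = 1≤m
      ; m≤k = m≤k
      ; descending = λ i 1≤i i<m →
          same-order (s≤s z≤n) (≤-trans i<m m≤k) 1≤i (≤-trans (<⇒≤ i<m) m≤k) (descending' i 1≤i i<m)
      ; ascending = λ i m≤i i<k →
          same-order (≤-trans 1≤m m≤i) (<⇒≤ i<k) (s≤s z≤n) i<k (ascending' i m≤i i<k)
      }

  data Kind (p : Cell) : Set where
    top-cell-kind : ∀ {i} → 1 ≤ i → i ≤ k → C i ≡ p → Kind p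
    low-cell-kind : T p ≤ n ∸ k → (∀ {i} → 1 ≤ i → i ≤ k → C i ≢ p) → Kind p

  kind : ∀ {p} → InShape lam mu p → Kind p
  kind {p} p∈ with n ∸ k <? T p
  ... | yes big = let i , 1≤i , i≤k , Ci≡p = top-cell p∈ big in top-cell-kind 1≤i i≤k Ci≡p
  ... | no small = low-cell-kind (≮⇒≥ small)
                     (λ 1≤i i≤k Ci≡p → small (subst (λ x → n ∸ k < T x) Ci≡p (top-value 1≤i i≤k)))

  module Permuted {π ρ : ℕ → ℕ} (inv : InverseOn k π ρ) {U : Tableau}
    (U-top : ∀ {i} → 1 ≤ i → i ≤ k → U (C i) ≡ T (C (π i)))
    (U-low : ∀ {p} → (∀ {i} → 1 ≤ i → i ≤ k → C i ≢ p) → U p ≡ T p)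
    (east-ok : ∀ {l} → 1 ≤ l → suc l ≤ k → C (suc l) ≡ east-of (C l) → T (C (π l)) < T (C (π (suc l))))
    (south-ok : ∀ {l} → 1 ≤ l → suc l ≤ k → C l ≡ south-of (C (suc l)) → T (C (π (suc l))) < T (C (π l)))
    where
    open InverseOn inv

    Cπ-inShape : ∀ {i} → 1 ≤ i → i ≤ k → InShape lam mu (C (π i))
    Cπ-inShape 1≤i i≤k = let 1≤πi , πi≤k = π-closed 1≤i i≤k in C-inShape 1≤πi πi≤k

    U-top-value : ∀ {i} → 1 ≤ i → i ≤ k → n ∸ k < U (C i)
    U-top-value 1≤i i≤k =
      let 1≤πi , πi≤k = π-closed 1≤i i≤k in subst (n ∸ k <_) (sym (U-top 1≤i i≤k)) (top-value 1≤πi πi≤k)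

    U-range : ∀ {p} → InShape lam mu p → 1 ≤ U p × U p ≤ n
    U-range {p} p∈ with kind p∈
    ... | top-cell-kind 1≤i i≤k refl =
      subst (λ v → 1 ≤ v × v ≤ n) (sym (U-top 1≤i i≤k)) (range _ (Cπ-inShape 1≤i i≤k))
    ... | low-cell-kind _ not-top = subst (λ v → 1 ≤ v × v ≤ n) (sym (U-low not-top)) (range p p∈)

    U-injective : ∀ p q → InShape lam mu p → InShape lam mu q → U p ≡ U q → p ≡ q
    U-injective p q p∈ q∈ Up≡Uq with kind p∈ | kind q∈
    ... | top-cell-kind 1≤i i≤k refl | top-cell-kind 1≤i' i'≤k refl = cong C i≡i'
      where
      πi≡πi' : π _ ≡ π _
      πi≡πi' = TC-injective (proj₁ (π-closed 1≤i i≤k)) (proj₂ (π-closed 1≤i i≤k))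
                            (proj₁ (π-closed 1≤i' i'≤k)) (proj₂ (π-closed 1≤i' i'≤k))
                            (trans (sym (U-top 1≤i i≤k)) (trans Up≡Uq (U-top 1≤i' i'≤k)))
      i≡i' : _ ≡ _
      i≡i' = trans (sym (ρ∘π 1≤i i≤k)) (trans (cong ρ πi≡πi') (ρ∘π 1≤i' i'≤k))
    ... | top-cell-kind 1≤i i≤k refl | low-cell-kind small not-top =
      ⊥-elim (<⇒≱ (U-top-value 1≤i i≤k) (subst (_≤ n ∸ k) (sym (trans Up≡Uq (U-low not-top))) small))
    ... | low-cell-kind small not-top | top-cell-kind 1≤i i≤k refl =
      ⊥-elim (<⇒≱ (U-top-value 1≤i i≤k) (subst (_≤ n ∸ k) (sym (trans (sym Up≡Uq) (U-low not-top))) small))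
    ... | low-cell-kind _ not-top-p | low-cell-kind _ not-top-q =
      inj p q p∈ q∈ (trans (sym (U-low not-top-p)) (trans Up≡Uq (U-low not-top-q)))

    U-surjective : ∀ v → 1 ≤ v → v ≤ n → ∃[ p ] (InShape lam mu p × U p ≡ v)
    U-surjective v 1≤v v≤n with n ∸ k <? v
    ... | yes big =
      let i , 1≤i , i≤k , TCi≡v = covers v big v≤n
          1≤ρi , ρi≤k = ρ-closed 1≤i i≤k
      in C (ρ i) , C-inShape 1≤ρi ρi≤k ,
         trans (U-top 1≤ρi ρi≤k) (trans (cong (T ∘ C) (π∘ρ 1≤i i≤k)) TCi≡v)
    ... | no small with surj v 1≤v v≤n
    ...   | q , q∈ , Tq≡v with kind q∈
    ...     | top-cell-kind 1≤i i≤k refl = ⊥-elim (small (subst (n ∸ k <_) Tq≡v (top-value 1≤i i≤k)))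
    ...     | low-cell-kind _ not-top = q , q∈ , trans (U-low not-top) Tq≡v

    U-increasing : ∀ {p q} → InShape lam mu p → InShape lam mu q → T p < T q →
                   (∀ {l l'} → 1 ≤ l → l ≤ k → 1 ≤ l' → l' ≤ k → C l ≡ p → C l' ≡ q →
                      T (C (π l)) < T (C (π l'))) →
                   U p < U q
    U-increasing p∈ q∈ Tp<Tq top-ok with kind p∈ | kind q∈
    ... | top-cell-kind 1≤l l≤k refl | top-cell-kind 1≤l' l'≤k refl =
      subst₂ _<_ (sym (U-top 1≤l l≤k)) (sym (U-top 1≤l' l'≤k)) (top-ok 1≤l l≤k 1≤l' l'≤k refl refl)
    ... | top-cell-kind 1≤l l≤k refl | low-cell-kind small _ =
      ⊥-elim (<⇒≱ (<-trans (top-value 1≤l l≤k) Tp<Tq) small)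
    ... | low-cell-kind small not-top | top-cell-kind 1≤l' l'≤k refl =
      subst₂ _<_ (sym (U-low not-top)) refl (≤-<-trans small (U-top-value 1≤l' l'≤k))
    ... | low-cell-kind _ not-top-p | low-cell-kind _ not-top-q =
      subst₂ _<_ (sym (U-low not-top-p)) (sym (U-low not-top-q)) Tp<Tq

    east-step : ∀ {r c l l'} → 1 ≤ l → l ≤ k → 1 ≤ l' → l' ≤ k → C l ≡ (r , c) → C l' ≡ (r , suc c) →
                T (C (π l)) < T (C (π l'))
    east-step 1≤l l≤k 1≤l' l'≤k refl Cl'≡east with east-neighbour-index 1≤l l≤k 1≤l' l'≤k Cl'≡east
    ... | refl = east-ok 1≤l l'≤k Cl'≡east

    south-step : ∀ {r c l l'} → 1 ≤ l → l ≤ k → 1 ≤ l' → l' ≤ k → C l ≡ (r , c) → C l' ≡ (suc r , c) →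
                 T (C (π l)) < T (C (π l'))
    south-step 1≤l l≤k 1≤l' l'≤k refl Cl'≡south with south-neighbour-index 1≤l l≤k 1≤l' l'≤k Cl'≡south
    ... | refl = south-ok 1≤l' l≤k Cl'≡south

    isSYT : IsSYT lam mu U
    isSYT = record
      { range  = λ _ → U-range
      ; inj    = U-injective
      ; surj   = U-surjective
      ; rowInc = λ r c p∈ q∈ → U-increasing p∈ q∈ (rowInc r c p∈ q∈) east-step
      ; colInc = λ r c p∈ q∈ → U-increasing p∈ q∈ (colInc r c p∈ q∈) south-step
      }

findIdx-miss : ∀ {C p b} → (∀ {i} → 1 ≤ i → i ≤ b → C i ≢ p) → findIdx C p b ≡ nothing
findIdx-miss {b = zero} _ = refl
findIdx-miss {C} {p} {suc b} miss rewrite findIdx-miss {C} {p} {b} (λ 1≤i i≤b → miss 1≤i (m≤n⇒m≤1+n i≤b))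
  with C (suc b) ≟c p
... | yes hit = ⊥-elim (miss (s≤s z≤n) ≤-refl hit)
... | no _    = refl

findIdx-first : ∀ {C i b} → (∀ {i'} → 1 ≤ i' → i' < i → C i' ≢ C i) → 1 ≤ i → i ≤ b →
                findIdx C (C i) b ≡ just i
findIdx-first {b = zero} _ (s≤s _) ()
findIdx-first {C} {i} {suc b} first 1≤i i≤1+b with m≤n⇒m<n∨m≡n i≤1+b
... | inj₁ i<1+b rewrite findIdx-first {C} {i} {b} first 1≤i (≤-pred i<1+b) = refl
... | inj₂ refl rewrite findIdx-miss {C} {C i} {b} (λ 1≤i' i'≤b → first 1≤i' (s≤s i'≤b)) with C i ≟c C i
...   | yes _    = refl
...   | no Ci≢Ci = ⊥-elim (Ci≢Ci refl)

rot₁-missed : ∀ n C j T p → findIdx C p j ≡ nothing → rot₁ n C j T p ≡ T p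
rot₁-missed n C j T p found rewrite found = refl

rot₁-last : ∀ n C j T p → findIdx C p j ≡ just j → rot₁ n C j T p ≡ n
rot₁-last n C j T p found rewrite found with j ≟ j
... | yes _   = refl
... | no j≢j = ⊥-elim (j≢j refl)

rot₁-inner : ∀ n C j T p {i} → findIdx C p j ≡ just i → i ≢ j → rot₁ n C j T p ≡ T (C (suc i))
rot₁-inner n C j T p {i} found i≢j rewrite found with i ≟ j
... | yes i≡j = ⊥-elim (i≢j i≡j)
... | no _    = refl

rot₂-missed : ∀ n k C j T p → findIdx C p k ≡ nothing → rot₂ n k C j T p ≡ T p
rot₂-missed n k C j T p found rewrite found = refl

rot₂-pivot : ∀ n k C j T p → findIdx C p k ≡ just j → rot₂ n k C j T p ≡ n
rot₂-pivot n k C j T p found rewrite found with j ≟ j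
... | yes _   = refl
... | no j≢j = ⊥-elim (j≢j refl)

rot₂-above : ∀ n k C j T p {i} → findIdx C p k ≡ just i → j < i → rot₂ n k C j T p ≡ T (C (pred i))
rot₂-above n k C j T p {i} found j<i rewrite found with i ≟ j
... | yes refl = ⊥-elim (<-irrefl refl j<i)
... | no _ with j <? i
...   | yes _   = refl
...   | no j≮i = ⊥-elim (j≮i j<i)

rot₂-below : ∀ n k C j T p {i} → findIdx C p k ≡ just i → i < j → rot₂ n k C j T p ≡ T p
rot₂-below n k C j T p {i} found i<j rewrite found with i ≟ j
... | yes refl = ⊥-elim (<-irrefl refl i<j)
... | no _ with j <? i
...   | yes j<i = ⊥-elim (<-asym i<j j<i)
...   | no _    = refl

module Rotations {lam mu : List ℕ} (λ-partition : IsPartition lam) (μ-partition : IsPartition mu)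
                 {T : Tableau} (syt : IsSYT lam mu T)
                 {k : ℕ} {C : ℕ → Cell} (top : IsTopCells lam mu T k C)
                 {m : ℕ} (valley : Valley (T ∘ C) k m) where
  open TopCells syt top
  open Shape {lam} {mu} λ-partition μ-partition using (column-first-endpoint; row-first-endpoint)
  open Valley valley using (1≤m; m≤k; maximum-at-end)
  open ValleyRotation valley C-bounded TC-injective

  last-is-max : T (C 1) ≢ n → 1 ≤ k → T (C k) ≡ n
  last-is-max C1≢n 1≤k with IsTopCells.covers top n (∸-monoʳ-< {n} {k} {0} 1≤k (IsTopCells.bound top)) ≤-refl
  ... | i , 1≤i , i≤k , TCi≡n with maximum-at-end C-bounded 1≤i i≤k TCi≡n
  ...   | inj₁ refl = ⊥-elim (C1≢n TCi≡n)
  ...   | inj₂ refl = TCi≡n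

  rot₁-isSYT : T (C 1) ≡ n → ∀ {j} → 1 ≤ j → j ≤ k → IsCorner lam mu (C j) →
               ¬ InShape lam mu (south-of (C m)) ⊎ C j ≺ C m → IsSYT lam mu (rot₁ n C j T)
  rot₁-isSYT C1≡n {j} 1≤j j≤k (Cj-no-south , Cj-no-east) bottom-ok =
    Permuted.isSYT (cycle-inverse ≤-refl 1≤j j≤k) U-top U-low east-ok south-ok
    where
    U-top : ∀ {i} → 1 ≤ i → i ≤ k → rot₁ n C j T (C i) ≡ T (C (next 1 j i))
    U-top {i} 1≤i i≤k with next-cases {1} {j} i
    ... | inj₁ refl =
      trans (rot₁-last n C j T _ (findIdx-first (C-first 1≤i i≤k) 1≤i ≤-refl))
            (trans (sym C1≡n) (cong (T ∘ C) (sym (next-last {1} {j}))))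
    ... | inj₂ (inj₁ (_ , i<j)) =
      trans (rot₁-inner n C j T _ (findIdx-first (C-first 1≤i i≤k) 1≤i (<⇒≤ i<j)) (<⇒≢ i<j))
            (cong (T ∘ C) (sym (next-inside 1≤i i<j)))
    ... | inj₂ (inj₂ (i≢j , ¬inside)) =
      trans (rot₁-missed n C j T _ (findIdx-miss before-i)) (cong (T ∘ C) (sym (next-outside i≢j ¬inside)))
      where
      j<i : j < i
      j<i = ≤∧≢⇒< (≮⇒≥ (λ i<j → ¬inside (1≤i , i<j))) (i≢j ∘ sym)
      before-i : ∀ {i'} → 1 ≤ i' → i' ≤ j → C i' ≢ C i
      before-i 1≤i' i'≤j = C-first 1≤i i≤k 1≤i' (≤-<-trans i'≤j j<i)

    U-low : ∀ {p} → (∀ {i} → 1 ≤ i → i ≤ k → C i ≢ p) → rot₁ n C j T p ≡ T p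
    U-low not-top = rot₁-missed n C j T _ (findIdx-miss (λ 1≤i i≤j → not-top 1≤i (≤-trans i≤j j≤k)))

    east-ok : ∀ {l} → 1 ≤ l → suc l ≤ k → C (suc l) ≡ east-of (C l) →
              T (C (next 1 j l)) < T (C (next 1 j (suc l)))
    east-ok {l} 1≤l l<k east-nb = FirstMax.ascent-preserved C1≡n j≤k 1≤l l<k l≢j
                                    (T-east (C-inShape 1≤l (<⇒≤ l<k)) (C-inShape (s≤s z≤n) l<k) east-nb)
      where
      l≢j : l ≢ j
      l≢j refl = Cj-no-east (subst (InShape lam mu) east-nb (C-inShape (s≤s z≤n) l<k))

    south-ok : ∀ {l} → 1 ≤ l → suc l ≤ k → C l ≡ south-of (C (suc l)) →
               T (C (next 1 j (suc l))) < T (C (next 1 j l))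
    south-ok {l} 1≤l l<k south-nb = FirstMax.descent-preserved C1≡n j≤k 1≤l l<k l+1≢j ¬bottom
                                      (T-south (C-inShape (s≤s z≤n) l<k) (C-inShape 1≤l (<⇒≤ l<k)) south-nb)
      where
      l+1≢j : suc l ≢ j
      l+1≢j refl = Cj-no-south (subst (InShape lam mu) south-nb (C-inShape 1≤l (<⇒≤ l<k)))
      ¬bottom : ¬ (suc l ≡ m × m < j)
      ¬bottom (refl , m<j) = case bottom-ok of λ
        { (inj₁ Cm-no-south) → Cm-no-south (subst (InShape lam mu) south-nb (C-inShape 1≤l (<⇒≤ l<k)))
        ; (inj₂ Cj≺Cm) → <-asym m<j (C-reflects 1≤j j≤k 1≤m m≤k Cj≺Cm) }

  rot₂-isSYT : T (C k) ≡ n → ∀ {j} → 1 ≤ j → j ≤ k → IsCorner lam mu (C j) →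
               ¬ InShape lam mu (east-of (C m)) ⊎ C m ≺ C j → IsSYT lam mu (rot₂ n k C j T)
  rot₂-isSYT Ck≡n {j} 1≤j j≤k (Cj-no-south , Cj-no-east) bottom-ok =
    Permuted.isSYT (InverseOn-sym (cycle-inverse 1≤j j≤k ≤-refl)) U-top U-low east-ok south-ok
    where
    U-top : ∀ {i} → 1 ≤ i → i ≤ k → rot₂ n k C j T (C i) ≡ T (C (prev j k i))
    U-top {i} 1≤i i≤k with prev-cases {j} {k} i
    ... | inj₁ refl =
      trans (rot₂-pivot n k C j T _ (findIdx-first (C-first 1≤i i≤k) 1≤i i≤k))
            (trans (sym Ck≡n) (cong (T ∘ C) (sym (prev-first {j} {k}))))
    ... | inj₂ (inj₁ (j<i , _)) =
      trans (rot₂-above n k C j T _ (findIdx-first (C-first 1≤i i≤k) 1≤i i≤k) j<i)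
            (cong (T ∘ C) (sym (prev-inside j<i i≤k)))
    ... | inj₂ (inj₂ (i≢j , ¬inside)) =
      trans (rot₂-below n k C j T _ (findIdx-first (C-first 1≤i i≤k) 1≤i i≤k) i<j)
            (cong (T ∘ C) (sym (prev-outside i≢j ¬inside)))
      where
      i<j : i < j
      i<j = ≤∧≢⇒< (≮⇒≥ (λ j<i → ¬inside (j<i , i≤k))) i≢j

    U-low : ∀ {p} → (∀ {i} → 1 ≤ i → i ≤ k → C i ≢ p) → rot₂ n k C j T p ≡ T p
    U-low not-top = rot₂-missed n k C j T _ (findIdx-miss not-top)

    east-ok : ∀ {l} → 1 ≤ l → suc l ≤ k → C (suc l) ≡ east-of (C l) →
              T (C (prev j k l)) < T (C (prev j k (suc l)))
    east-ok {l} 1≤l l<k east-nb = LastMax.ascent-preserved Ck≡n 1≤j 1≤l l<k l≢j ¬bottom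
                                    (T-east (C-inShape 1≤l (<⇒≤ l<k)) (C-inShape (s≤s z≤n) l<k) east-nb)
      where
      l≢j : l ≢ j
      l≢j refl = Cj-no-east (subst (InShape lam mu) east-nb (C-inShape (s≤s z≤n) l<k))
      ¬bottom : ¬ (l ≡ m × j < m)
      ¬bottom (refl , j<m) = case bottom-ok of λ
        { (inj₁ Cm-no-east) → Cm-no-east (subst (InShape lam mu) east-nb (C-inShape (s≤s z≤n) l<k))
        ; (inj₂ Cm≺Cj) → <-asym j<m (C-reflects 1≤m m≤k 1≤j j≤k Cm≺Cj) }

    south-ok : ∀ {l} → 1 ≤ l → suc l ≤ k → C l ≡ south-of (C (suc l)) →
               T (C (prev j k (suc l))) < T (C (prev j k l))
    south-ok {l} 1≤l l<k south-nb = LastMax.descent-preserved Ck≡n 1≤j 1≤l l<k l+1≢j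
                                      (T-south (C-inShape (s≤s z≤n) l<k) (C-inShape 1≤l (<⇒≤ l<k)) south-nb)
      where
      l+1≢j : suc l ≢ j
      l+1≢j refl = Cj-no-south (subst (InShape lam mu) south-nb (C-inShape 1≤l (<⇒≤ l<k)))

  rotSE-isSYT : 1 ≤ k → ∀ {j} → 1 ≤ j → j ≤ k → SEEndpoint lam mu T C (C m) (C j) →
                IsSYT lam mu (rotSE n k C j T)
  rotSE-isSYT 1≤k 1≤j j≤k endpoint with T (C 1) ≟ n | endpoint
  ... | yes C1≡n | inj₁ (_ , _ , column-end , shape) =
    let corner , bottom = column-first-endpoint (IsTopCells.onSEB top m 1≤m m≤k) column-end shape
    in rot₁-isSYT C1≡n 1≤j j≤k corner bottom
  ... | no C1≢n | inj₂ (_ , _ , row-end , shape) =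
    let corner , bottom = row-first-endpoint (IsTopCells.onSEB top m 1≤m m≤k) row-end shape
    in rot₂-isSYT (last-is-max C1≢n 1≤k) 1≤j j≤k corner bottom
  ... | yes C1≡n | inj₂ (C1≢n , _) = ⊥-elim (C1≢n C1≡n)
  ... | no C1≢n | inj₁ (C1≡n , _) = ⊥-elim (C1≢n C1≡n)

mainTheorem4 : (lam mu : List ℕ) → IsPartition lam → IsPartition mu → mu ⊆ₚ lam →
    (T : Tableau) → IsSYT lam mu T →
    (k : ℕ) → IsRcSESize lam mu T k →
    (C : ℕ → Cell) → IsTopCells lam mu T k C →
    (Y : Cell) → InShape lam mu Y → T Y ≡ size lam mu ∸ k + 1 →
    (X : Cell) → SEEndpoint lam mu T C Y X →
    (j : ℕ) → 1 ≤ j → j ≤ k → C j ≡ X →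
    IsSYT lam mu (rotSE (size lam mu) k C j T)
mainTheorem4 lam mu λ-partition μ-partition _ T syt k (1≤k , unimodal , _) C top Y Y∈ TY X endpoint j 1≤j j≤k refl
  with TopCells.valley-of syt top unimodal
... | m , valley , TCm with IsSYT.inj syt (C m) Y (TopCells.C-inShape syt top (Valley.1≤m valley) (Valley.m≤k valley))
                                                  Y∈ (trans TCm (sym TY))
... | refl = Rotations.rotSE-isSYT λ-partition μ-partition syt top valley 1≤k 1≤j j≤k endpoint
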